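{- Let $(G,k)$ be a reduced instance of \textsc{Trivially Perfect Editing} such that (a) no true twin class of $G$ has size greater than $2k+5$, and (b) there is no module $M\subseteq V(G)$ with $G[M]$ trivially perfect and containing an independent set of size at least $2k+5$. Then every module $M\subseteq V(G)$ such that $G[M]$ is trivially perfect satisfies $|M|=O(k^2)$.
   Context: Graphs are finite, simple, undirected; a graph is trivially perfect if it has no induced $C_4$ or $P_4$. \textsc{Trivially Perfect Editing}: given $(G,k)$, decide if some $S\subseteq\binom{V(G)}{2}$, $|S|\le k$, makes $(V(G),E(G)\triangle S)$ trivially perfect. The instance $(G,k)$ is reduced if neither of the following holds: (i) there is a non-edge $uv$ such that the complement of $G[N(u)\cap N(v)]$ has a matching of size $\ge k+1$; (ii) there is an edge $uv$ and $k+1$ pairwise disjoint non-adjacent pairs $\{a,b\}$ with $a\in N(u)\setminus N[v]$, $b\in N(v)\setminus N[u]$. A module is a set $M\subseteq V(G)$ with $N(u)\setminus M=N(v)\setminus M$ for all $u,v\in M$. A true twin class is an inclusion-wise maximal set of vertices with pairwise equal closed neighborhoods. $O(k^2)$ means at most $c\,k^2$ for an absolute constant $c$ (for $k\ge1$). -}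

module Defs where

open import Data.Nat using (ℕ; suc; _+_; _*_; _≤_; _>_)
open import Data.Fin using (Fin)
open import Data.Fin.Subset using (Subset; _∈_; _∉_; _⊆_; ∣_∣)
open import Data.Bool using (Bool; T)
open import Data.Sum using (_⊎_; [_,_])
open import Data.Product using (Σ; _×_; ∃; ∃-syntax)
open import Data.Empty using (⊥)
open import Relation.Nullary using (¬_)
open import Relation.Binary.PropositionalEquality using (_≡_; _≢_)
open import Function.Definitions using (Injective)
open import Function.Bundles using (_⇔_)

record Graph (n : ℕ) : Set where
  field
    adj     : Fin n → Fin n → Bool
    symm    : ∀ x y → adj x y ≡ adj y x
    irrefl  : ∀ x → adj x x ≡ Data.Bool.false

open Graph public

module _ {n : ℕ} (G : Graph n) where

  Adj : Fin n → Fin n → Set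
  Adj x y = T (adj G x y)

  InClosedNbh : Fin n → Fin n → Set
  InClosedNbh v x = (x ≡ v) ⊎ Adj v x

  InducedC4In : Subset n → Set
  InducedC4In M = Σ (Fin n) λ a → Σ (Fin n) λ b → Σ (Fin n) λ c → Σ (Fin n) λ d →
    (a ∈ M × b ∈ M × c ∈ M × d ∈ M) ×
    (a ≢ b × a ≢ c × a ≢ d × b ≢ c × b ≢ d × c ≢ d) ×
    (Adj a b × Adj b c × Adj c d × Adj d a) ×
    (¬ Adj a c × ¬ Adj b d)

  InducedP4In : Subset n → Set
  InducedP4In M = Σ (Fin n) λ a → Σ (Fin n) λ b → Σ (Fin n) λ c → Σ (Fin n) λ d →
    (a ∈ M × b ∈ M × c ∈ M × d ∈ M) ×
    (a ≢ b × a ≢ c × a ≢ d × b ≢ c × b ≢ d × c ≢ d) ×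
    (Adj a b × Adj b c × Adj c d) ×
    (¬ Adj a c × ¬ Adj b d × ¬ Adj a d)

  TriviallyPerfectOn : Subset n → Set
  TriviallyPerfectOn M = ¬ InducedC4In M × ¬ InducedP4In M

  -- k+1 pairwise disjoint pairs {a i, b i}: all 2(k+1) endpoints distinct
  DisjointPairs : (k : ℕ) → (Fin (suc k) → Fin n) → (Fin (suc k) → Fin n) → Set
  DisjointPairs k a b = Injective _≡_ _≡_ [ a , b ]

  -- rule (i) applies: a non-edge uv such that the complement of G[N(u) ∩ N(v)]
  -- has a matching of size ≥ k+1 (equivalently of size exactly k+1)
  RuleOneApplies : ℕ → Set
  RuleOneApplies k = Σ (Fin n) λ u → Σ (Fin n) λ v → u ≢ v × ¬ Adj u v ×
    Σ (Fin (suc k) → Fin n) λ a → Σ (Fin (suc k) → Fin n) λ b →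
      DisjointPairs k a b ×
      (∀ i → Adj u (a i) × Adj v (a i) × Adj u (b i) × Adj v (b i) × ¬ Adj (a i) (b i))

  RuleTwoApplies : ℕ → Set
  RuleTwoApplies k = Σ (Fin n) λ u → Σ (Fin n) λ v → Adj u v ×
    Σ (Fin (suc k) → Fin n) λ a → Σ (Fin (suc k) → Fin n) λ b →
      DisjointPairs k a b ×
      (∀ i → (Adj u (a i) × ¬ InClosedNbh v (a i)) ×
             (Adj v (b i) × ¬ InClosedNbh u (b i)) ×
             ¬ Adj (a i) (b i))

  Reduced : ℕ → Set
  Reduced k = ¬ RuleOneApplies k × ¬ RuleTwoApplies k

  IsModule : Subset n → Set
  IsModule M = ∀ u v w → u ∈ M → v ∈ M → w ∉ M → Adj u w ⇔ Adj v w

  TrueTwinSet : Subset n → Set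
  TrueTwinSet T = ∀ x y → x ∈ T → y ∈ T → ∀ w → InClosedNbh x w ⇔ InClosedNbh y w

  TrueTwinClass : Subset n → Set
  TrueTwinClass T = TrueTwinSet T × (∀ T′ → T ⊆ T′ → TrueTwinSet T′ → T′ ⊆ T)

  IndependentSet : Subset n → Set
  IndependentSet I = ∀ x y → x ∈ I → y ∈ I → ¬ Adj x y

-- A trivially perfect graph has a vertex x of maximum degree whose closed neighbourhood is closed
-- under adjacency, since otherwise an induced P₄ or C₄ appears. So a trivially perfect module X
-- either splits into the modules X ∩ N[x] and X ∖ N[x] with no edges between them, or x is
-- universal in X. In the latter case every universal vertex of X is a true twin of x, so removing
-- them costs at most t vertices (the twin-class bound) and leaves a module without universal
-- vertex, which splits.
-- Induction yields an independent I ⊆ X with |X| + t ≤ 2t|I|; with t = 2k + 5 and |I| < 2k + 5 this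
-- gives |M| ≤ 2(2k + 5)² ≤ 98k².

module Submission where

open import Defs
open import Data.Nat using (ℕ; _+_; _*_; _≤_)
open import Data.Fin.Subset using (Subset; _⊆_; ∣_∣)
open import Data.Product using (Σ; _×_)
open import Relation.Nullary using (¬_)

open import Data.Nat using (suc; _<_; z≤n)
open import Data.Nat.Properties
  using (+-suc; +-identityʳ; ≤-reflexive; ≤-trans; ≤⇒≯; ≰⇒>; <⇒≤; m≤m+n; m≤n*m;
         +-monoˡ-≤; +-monoʳ-≤; +-mono-≤; *-monoʳ-≤; module ≤-Reasoning)
open import Data.Nat.Tactic.RingSolver using (solve-∀)
open import Data.Fin using (Fin; _≟_)
open import Data.Fin.Properties using (any?; all?)
open import Data.Fin.Subset
  using (_∈_; _∉_; _⊂_; _∩_; _∪_; _─_; ⁅_⁆; Nonempty; inside; outside)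
open import Data.Fin.Subset.Properties
  using (_∈?_; nonempty?; Empty-unique; ∣⊥∣≡0; ∣⁅x⁆∣≡1; x∈⁅y⁆⇒x≡y; p⊆q⇒∣p∣≤∣q∣; p⊂q⇒∣p∣<∣q∣; ⊂-trans;
         x∈p∩q⁺; x∈p∩q⁻; p∩q⊆p; ∣p∩q∣≤∣q∣; x∈p∪q⁻; x∈p∧x∉q⇒x∈p─q; p─q⊆p; p∩q≢∅⇒p─q⊂p)
open import Data.Fin.Subset.Induction using (⊂-wellFounded)
open import Data.Vec using ([]; _∷_; tabulate; here; there)
open import Data.Vec.Properties using (lookup∘tabulate; lookup⇒[]=; []=⇒lookup)
open import Data.List using (filter; allFin)
open import Data.List.Extrema.Nat using (argmax; argmax-all; f[xs]≤f[argmax])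
open import Data.List.Membership.Propositional.Properties using (∈-filter⁺; ∈-allFin)
open import Data.List.Relation.Unary.All using (lookup)
open import Data.List.Relation.Unary.All.Properties using (all-filter)
open import Data.Product using (_,_; proj₂; uncurry; Σ-syntax)
open import Data.Sum using (_⊎_; inj₁; inj₂)
open import Data.Empty using (⊥; ⊥-elim)
open import Data.Bool using (T; T?)
open import Function using (_∘_; const)
open import Function.Properties.Equivalence using () renaming (refl to ⇔-refl)
open import Function.Bundles using (_⇔_; mk⇔; Equivalence)
open import Induction.WellFounded using (module All; WfRec)
open import Level using (0ℓ)
open import Relation.Nullary using (Dec; yes; no; does; ¬?)
open import Relation.Nullary.Decidable using (map′; dec-true; _×-dec_; _⊎-dec_; _→-dec_)
open import Relation.Binary.PropositionalEquality using (_≡_; _≢_; refl; sym; trans; cong; subst; module ≡-Reasoning)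
open import Relation.Unary using (Pred; Decidable)

open Equivalence using (to; from)

private
  variable
    n : ℕ

subsetOf : {P : Pred (Fin n) 0ℓ} → Decidable P → Subset n
subsetOf P? = tabulate (does ∘ P?)

module _ {P : Pred (Fin n) 0ℓ} (P? : Decidable P) where

  ∈-subsetOf⁺ : ∀ {x} → P x → x ∈ subsetOf P?
  ∈-subsetOf⁺ {x} p = lookup⇒[]= x _ (trans (lookup∘tabulate _ x) (dec-true (P? x) p))

  ∈-subsetOf⁻ : ∀ {x} → x ∈ subsetOf P? → P x
  ∈-subsetOf⁻ {x} x∈ with P? x | trans (sym (lookup∘tabulate (does ∘ P?) x)) ([]=⇒lookup x∈)
  ... | yes p | _ = p
  ... | no _  | ()

x∈p─q⇒x∉q : ∀ {x : Fin n} (p q : Subset n) → x ∈ p ─ q → x ∉ q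
x∈p─q⇒x∉q (inside ∷ p) (outside ∷ q) here      ()
x∈p─q⇒x∉q (_ ∷ p)      (_ ∷ q)       (there m) (there m′) = x∈p─q⇒x∉q p q m m′

∣p∣≡∣p∩q∣+∣p─q∣ : (p q : Subset n) → ∣ p ∣ ≡ ∣ p ∩ q ∣ + ∣ p ─ q ∣
∣p∣≡∣p∩q∣+∣p─q∣ []            []            = refl
∣p∣≡∣p∩q∣+∣p─q∣ (inside ∷ p)  (inside ∷ q)  = cong suc (∣p∣≡∣p∩q∣+∣p─q∣ p q)
∣p∣≡∣p∩q∣+∣p─q∣ (inside ∷ p)  (outside ∷ q) = trans (cong suc (∣p∣≡∣p∩q∣+∣p─q∣ p q)) (sym (+-suc _ _))
∣p∣≡∣p∩q∣+∣p─q∣ (outside ∷ p) (inside ∷ q)  = ∣p∣≡∣p∩q∣+∣p─q∣ p q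
∣p∣≡∣p∩q∣+∣p─q∣ (outside ∷ p) (outside ∷ q) = ∣p∣≡∣p∩q∣+∣p─q∣ p q

∣p∪q∣+∣p∩q∣≡∣p∣+∣q∣ : (p q : Subset n) → ∣ p ∪ q ∣ + ∣ p ∩ q ∣ ≡ ∣ p ∣ + ∣ q ∣
∣p∪q∣+∣p∩q∣≡∣p∣+∣q∣ []            []            = refl
∣p∪q∣+∣p∩q∣≡∣p∣+∣q∣ (inside ∷ p)  (inside ∷ q)  =
  cong suc (trans (+-suc _ _) (trans (cong suc (∣p∪q∣+∣p∩q∣≡∣p∣+∣q∣ p q)) (sym (+-suc _ _))))
∣p∪q∣+∣p∩q∣≡∣p∣+∣q∣ (inside ∷ p)  (outside ∷ q) = cong suc (∣p∪q∣+∣p∩q∣≡∣p∣+∣q∣ p q)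
∣p∪q∣+∣p∩q∣≡∣p∣+∣q∣ (outside ∷ p) (inside ∷ q)  = trans (cong suc (∣p∪q∣+∣p∩q∣≡∣p∣+∣q∣ p q)) (sym (+-suc _ _))
∣p∪q∣+∣p∩q∣≡∣p∣+∣q∣ (outside ∷ p) (outside ∷ q) = ∣p∪q∣+∣p∩q∣≡∣p∣+∣q∣ p q

x∈p∧x∉p─q⇒x∈q : ∀ {x : Fin n} {p q : Subset n} → x ∈ p → x ∉ p ─ q → x ∈ q
x∈p∧x∉p─q⇒x∈q {x = x} {q = q} x∈p x∉p─q with x ∈? q
... | yes x∈q = x∈q
... | no  x∉q = ⊥-elim (x∉p─q (x∈p∧x∉q⇒x∈p─q x∈p x∉q))

disjoint⇒∣p∣+∣q∣≡∣p∪q∣ : (p q : Subset n) → (∀ {x} → x ∈ p → x ∉ q) → ∣ p ∣ + ∣ q ∣ ≡ ∣ p ∪ q ∣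
disjoint⇒∣p∣+∣q∣≡∣p∪q∣ {n} p q disjoint = begin
  ∣ p ∣ + ∣ q ∣             ≡⟨ ∣p∪q∣+∣p∩q∣≡∣p∣+∣q∣ p q ⟨
  ∣ p ∪ q ∣ + ∣ p ∩ q ∣     ≡⟨ cong (∣ p ∪ q ∣ +_) ∣p∩q∣≡0 ⟩
  ∣ p ∪ q ∣ + 0             ≡⟨ +-identityʳ _ ⟩
  ∣ p ∪ q ∣                 ∎
  where
  open ≡-Reasoning
  ∣p∩q∣≡0 : ∣ p ∩ q ∣ ≡ 0
  ∣p∩q∣≡0 = trans (cong ∣_∣ (Empty-unique λ (x , x∈) → uncurry disjoint (x∈p∩q⁻ p q x∈))) (∣⊥∣≡0 n)

maximiser : (f : Fin n → ℕ) {X : Subset n} → Nonempty X →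
            Σ[ x ∈ Fin n ] x ∈ X × (∀ {z} → z ∈ X → f z ≤ f x)
maximiser {n} f {X} (x₀ , x₀∈X) =
  x , argmax-all f x₀∈X (all-filter (_∈? X) (allFin n)) ,
  λ z∈X → lookup (f[xs]≤f[argmax] x₀ members) (∈-filter⁺ (_∈? X) (∈-allFin _) z∈X)
  where
  members = filter (_∈? X) (allFin n)
  x = argmax f x₀ members

module _ (x t : ℕ) where

  open ≤-Reasoning

  split-bound : ∀ {c r a b} → x ≤ c + r → c + t ≤ 2 * t * a → r + t ≤ 2 * t * b →
                x + 2 * t ≤ 2 * t * (a + b)
  split-bound {c} {r} {a} {b} x≤ c≤ r≤ = begin
    x + 2 * t            ≤⟨ +-monoˡ-≤ (2 * t) x≤ ⟩
    c + r + 2 * t        ≡⟨ regroup c r t ⟩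
    (c + t) + (r + t)    ≤⟨ +-mono-≤ c≤ r≤ ⟩
    2 * t * a + 2 * t * b ≡⟨ distrib t a b ⟩
    2 * t * (a + b)      ∎
    where
    regroup : ∀ c r t → c + r + 2 * t ≡ (c + t) + (r + t)
    regroup = solve-∀
    distrib : ∀ t a b → 2 * t * a + 2 * t * b ≡ 2 * t * (a + b)
    distrib = solve-∀

  peel-bound : ∀ {u x′ a} → x ≤ u + x′ → u ≤ t → x′ + 2 * t ≤ 2 * t * a → x + t ≤ 2 * t * a
  peel-bound {u} {x′} {a} x≤ u≤ x′≤ = begin
    x + t           ≤⟨ +-monoˡ-≤ t (≤-trans x≤ (+-monoˡ-≤ x′ u≤)) ⟩
    t + x′ + t      ≡⟨ regroup t x′ ⟩
    x′ + 2 * t      ≤⟨ x′≤ ⟩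
    2 * t * a       ∎
    where
    regroup : ∀ t x′ → t + x′ + t ≡ x′ + 2 * t
    regroup = solve-∀

  singleton-bound : x ≤ t → x + t ≤ 2 * t * 1
  singleton-bound x≤ = begin
    x + t     ≤⟨ +-monoˡ-≤ t x≤ ⟩
    t + t     ≡⟨ double t ⟩
    2 * t * 1 ∎
    where
    double : ∀ t → t + t ≡ 2 * t * 1
    double = solve-∀

  weaken-bound : ∀ {y} → x + 2 * t ≤ y → x + t ≤ y
  weaken-bound = ≤-trans (+-monoʳ-≤ x (m≤n*m t 2))

module _ (G : Graph n) where

  Adj-sym : ∀ {x y} → Adj G x y → Adj G y x
  Adj-sym {x} {y} = subst T (symm G x y)

  Adj⇒≢ : ∀ {x y} → Adj G x y → x ≢ y
  Adj⇒≢ {x} xx refl = subst T (irrefl G x) xx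

  Adj? : ∀ x y → Dec (Adj G x y)
  Adj? x y = T? (adj G x y)

  InClosedNbh? : ∀ x y → Dec (InClosedNbh G x y)
  InClosedNbh? x y = (y ≟ x) ⊎-dec Adj? x y

  InClosedNbh-sym : ∀ {x y} → InClosedNbh G x y → InClosedNbh G y x
  InClosedNbh-sym (inj₁ refl) = inj₁ refl
  InClosedNbh-sym (inj₂ xy)   = inj₂ (Adj-sym xy)

  InClosedNbh⇒Adj : ∀ {x y} → InClosedNbh G x y → x ≢ y → Adj G x y
  InClosedNbh⇒Adj (inj₁ refl) x≢x = ⊥-elim (x≢x refl)
  InClosedNbh⇒Adj (inj₂ xy)   _   = xy

  N[_] : Fin n → Subset n
  N[ x ] = subsetOf (InClosedNbh? x)

  ∈N⁺ : ∀ {x y} → InClosedNbh G x y → y ∈ N[ x ]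
  ∈N⁺ {x} = ∈-subsetOf⁺ (InClosedNbh? x)

  ∈N⁻ : ∀ {x y} → y ∈ N[ x ] → InClosedNbh G x y
  ∈N⁻ {x} = ∈-subsetOf⁻ (InClosedNbh? x)

  Twins : Fin n → Fin n → Set
  Twins x y = ∀ w → InClosedNbh G x w ⇔ InClosedNbh G y w

  Twins? : ∀ x y → Dec (Twins x y)
  Twins? x y = all? λ w → map′ (λ (f , g) → mk⇔ f g) (λ e → to e , from e)
                                 ((InClosedNbh? x w →-dec InClosedNbh? y w) ×-dec
                                  (InClosedNbh? y w →-dec InClosedNbh? x w))

  Twins-refl : ∀ {x} → Twins x x
  Twins-refl _ = ⇔-refl

  twinsOf : Fin n → Subset n
  twinsOf x = subsetOf (λ y → Twins? y x)

  ∈twinsOf⁺ : ∀ {x y} → Twins y x → y ∈ twinsOf x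
  ∈twinsOf⁺ {x} = ∈-subsetOf⁺ (λ y → Twins? y x)

  ∈twinsOf⁻ : ∀ {x y} → y ∈ twinsOf x → Twins y x
  ∈twinsOf⁻ {x} = ∈-subsetOf⁻ (λ y → Twins? y x)

  twinsOf-trueTwinClass : ∀ x → TrueTwinClass G (twinsOf x)
  twinsOf-trueTwinClass x = twinSet , maximal
    where
    twinSet : TrueTwinSet G (twinsOf x)
    twinSet y z y∈ z∈ w = mk⇔ (from (∈twinsOf⁻ z∈ w) ∘ to (∈twinsOf⁻ y∈ w))
                              (from (∈twinsOf⁻ y∈ w) ∘ to (∈twinsOf⁻ z∈ w))
    maximal : ∀ T′ → twinsOf x ⊆ T′ → TrueTwinSet G T′ → T′ ⊆ twinsOf x
    maximal T′ ⊆T′ twinSet′ {y} y∈ = ∈twinsOf⁺ (twinSet′ y x y∈ (⊆T′ (∈twinsOf⁺ Twins-refl)))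

  Universal : Subset n → Fin n → Set
  Universal X x = ∀ {z} → z ∈ X → InClosedNbh G x z

  Universal? : ∀ X x → Dec (Universal X x)
  Universal? X x = map′ (λ u {z} → u z) (λ u z → u {z})
                        (all? λ z → z ∈? X →-dec InClosedNbh? x z)

  universal-twins : ∀ {X x y} → IsModule G X → x ∈ X → y ∈ X →
                    Universal X x → Universal X y → Twins x y
  universal-twins {X} {x} {y} mod x∈ y∈ ux uy w with w ∈? X
  ... | yes w∈ = mk⇔ (const (uy w∈)) (const (ux w∈))
  ... | no w∉  = mk⇔ (inj₂ ∘ to (mod x y w x∈ y∈ w∉) ∘ adjacent x∈)
                     (inj₂ ∘ from (mod x y w x∈ y∈ w∉) ∘ adjacent y∈)
    where
    adjacent : ∀ {v} → v ∈ X → InClosedNbh G v w → Adj G v w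
    adjacent v∈ vw = InClosedNbh⇒Adj vw λ { refl → w∉ v∈ }

  twin-universal : ∀ {X x y} → Twins y x → Universal X x → Universal X y
  twin-universal yx ux z∈ = from (yx _) (ux z∈)

  module-⊆ : ∀ {X Y} → IsModule G X → Y ⊆ X →
             (∀ {w} → w ∈ X → w ∉ Y → (∀ {u} → u ∈ Y → Adj G u w) ⊎ (∀ {u} → u ∈ Y → ¬ Adj G u w)) →
             IsModule G Y
  module-⊆ {X} mod Y⊆X uniform u v w u∈ v∈ w∉Y with w ∈? X
  ... | no w∉X = mod u v w (Y⊆X u∈) (Y⊆X v∈) w∉X
  ... | yes w∈X with uniform w∈X w∉Y
  ...   | inj₁ all  = mk⇔ (const (all v∈)) (const (all u∈))
  ...   | inj₂ none = mk⇔ (⊥-elim ∘ none u∈) (⊥-elim ∘ none v∈)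

  ─twinsOf-universal : ∀ {X x w} → Universal X x → w ∈ X → w ∉ X ─ twinsOf x → Universal X w
  ─twinsOf-universal ux w∈X w∉X′ = twin-universal (∈twinsOf⁻ (x∈p∧x∉p─q⇒x∈q w∈X w∉X′)) ux

  module-─twinsOf : ∀ {X x} → IsModule G X → Universal X x → IsModule G (X ─ twinsOf x)
  module-─twinsOf {X} mod ux = module-⊆ mod (p─q⊆p X _) λ w∈X w∉X′ → inj₁ λ u∈X′ →
    Adj-sym (InClosedNbh⇒Adj (─twinsOf-universal ux w∈X w∉X′ (p─q⊆p X _ u∈X′))
                             λ { refl → w∉X′ u∈X′ })

  ─twinsOf-no-universal : ∀ {X x y} → IsModule G X → x ∈ X → Universal X x →
                          y ∈ X ─ twinsOf x → ¬ Universal (X ─ twinsOf x) y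
  ─twinsOf-no-universal {X} {x} {y} mod x∈ ux y∈X′ uy′ =
    x∈p─q⇒x∉q X _ y∈X′ (∈twinsOf⁺ (universal-twins mod (p─q⊆p X _ y∈X′) x∈ uy ux))
    where
    uy : Universal X y
    uy {w} w∈X with w ∈? X ─ twinsOf x
    ... | yes w∈X′ = uy′ w∈X′
    ... | no  w∉X′ = InClosedNbh-sym (─twinsOf-universal ux w∈X w∉X′ (p─q⊆p X _ y∈X′))

  TriviallyPerfectOn-⊆ : ∀ {X Y} → Y ⊆ X → TriviallyPerfectOn G X → TriviallyPerfectOn G Y
  TriviallyPerfectOn-⊆ Y⊆X (noC₄ , noP₄) =
    (λ { (a , b , c , d , (a∈ , b∈ , c∈ , d∈) , rest) →
           noC₄ (a , b , c , d , (Y⊆X a∈ , Y⊆X b∈ , Y⊆X c∈ , Y⊆X d∈) , rest) }) ,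
    (λ { (a , b , c , d , (a∈ , b∈ , c∈ , d∈) , rest) →
           noP₄ (a , b , c , d , (Y⊆X a∈ , Y⊆X b∈ , Y⊆X c∈ , Y⊆X d∈) , rest) })

  -- The path z–u–x–b induces a P₄, or a C₄ if z and b are adjacent.
  trivially-perfect-path : ∀ {X z u x b} → TriviallyPerfectOn G X →
                           z ∈ X → u ∈ X → x ∈ X → b ∈ X →
                           Adj G z u → Adj G u x → Adj G x b →
                           ¬ InClosedNbh G x z → ¬ InClosedNbh G u b → ⊥
  trivially-perfect-path {z = z} {b = b} (noC₄ , noP₄) z∈ u∈ x∈ b∈ zu ux xb x∌z u∌b = closing? (Adj? z b)
    where
    inX = z∈ , u∈ , x∈ , b∈
    ¬zx = x∌z ∘ inj₂ ∘ Adj-sym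
    ¬ub = u∌b ∘ inj₂
    distinct = Adj⇒≢ zu , x∌z ∘ inj₁ , (λ { refl → x∌z (inj₂ xb) }) ,
               Adj⇒≢ ux , u∌b ∘ inj₁ ∘ sym , Adj⇒≢ xb
    closing? : Dec (Adj G z b) → ⊥
    closing? (yes zb) = noC₄ (_ , _ , _ , _ , inX , distinct , (zu , ux , xb , Adj-sym zb) , ¬zx , ¬ub)
    closing? (no ¬zb) = noP₄ (_ , _ , _ , _ , inX , distinct , (zu , ux , xb) , ¬zx , ¬ub , ¬zb)

  ClosedNbhClosedIn : Subset n → Fin n → Set
  ClosedNbhClosedIn X x = ∀ {u z} → u ∈ X → InClosedNbh G x u → z ∈ X → Adj G u z → InClosedNbh G x z

  -- If u ∈ N[x] had a neighbour z ∉ N[x] in X, then either N[x] ⊆ N[u] within X, and u would have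
  -- larger degree, or some b ∈ N[x] ∖ N[u] completes a path z–u–x–b.
  maxDegree⇒closedNbhClosed : ∀ {X x} → TriviallyPerfectOn G X → x ∈ X →
                              (∀ {u} → u ∈ X → ∣ X ∩ N[ u ] ∣ ≤ ∣ X ∩ N[ x ] ∣) →
                              ClosedNbhClosedIn X x
  maxDegree⇒closedNbhClosed {X} {x} tp x∈ max {u} {z} u∈ xu z∈ uz with InClosedNbh? x z
  ... | yes xz = xz
  ... | no x∌z with xu | any? (λ b → b ∈? X ×-dec InClosedNbh? x b ×-dec ¬? (InClosedNbh? u b))
  ...   | inj₁ refl | _ = ⊥-elim (x∌z (inj₂ uz))
  ...   | inj₂ xu′ | yes (b , b∈ , xb , u∌b) =
          ⊥-elim (trivially-perfect-path tp z∈ u∈ x∈ b∈ (Adj-sym uz) (Adj-sym xu′) x~b x∌z u∌b)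
    where
    x~b : Adj G x b
    x~b = InClosedNbh⇒Adj xb λ { refl → u∌b (inj₂ (Adj-sym xu′)) }
  ...   | inj₂ _ | no ∄b =
          ⊥-elim (≤⇒≯ (max u∈) (p⊂q⇒∣p∣<∣q∣ (N[x]⊆N[u] , z , x∈p∩q⁺ (z∈ , ∈N⁺ (inj₂ uz)) , z∉N[x])))
    where
    N[x]⊆N[u] : X ∩ N[ x ] ⊆ X ∩ N[ u ]
    N[x]⊆N[u] {w} w∈ with x∈p∩q⁻ X _ w∈ | InClosedNbh? u w
    ... | w∈X , _   | yes uw = x∈p∩q⁺ (w∈X , ∈N⁺ uw)
    ... | w∈X , w∈N | no u∌w = ⊥-elim (∄b (w , w∈X , ∈N⁻ w∈N , u∌w))
    z∉N[x] : z ∉ X ∩ N[ x ]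
    z∉N[x] = x∌z ∘ ∈N⁻ ∘ proj₂ ∘ x∈p∩q⁻ X _

  independent-∪ : ∀ {I J} → IndependentSet G I → IndependentSet G J →
                  (∀ {a b} → a ∈ I → b ∈ J → ¬ Adj G a b) → IndependentSet G (I ∪ J)
  independent-∪ {I} {J} indI indJ cross a b a∈ b∈ with x∈p∪q⁻ I J a∈ | x∈p∪q⁻ I J b∈
  ... | inj₁ a∈I | inj₁ b∈I = indI a b a∈I b∈I
  ... | inj₂ a∈J | inj₂ b∈J = indJ a b a∈J b∈J
  ... | inj₁ a∈I | inj₂ b∈J = cross a∈I b∈J
  ... | inj₂ a∈J | inj₁ b∈I = cross b∈I a∈J ∘ Adj-sym

  independent-⁅⁆ : ∀ x → IndependentSet G ⁅ x ⁆
  independent-⁅⁆ x a b a∈ b∈ ab = Adj⇒≢ ab (trans (x∈⁅y⁆⇒x≡y x a∈) (sym (x∈⁅y⁆⇒x≡y x b∈)))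

  module _ (t : ℕ) (twinClass≤t : ∀ T → TrueTwinClass G T → ∣ T ∣ ≤ t) where

    IndependenceBound : ℕ → Subset n → Set
    IndependenceBound s X = Σ[ I ∈ Subset n ] I ⊆ X × IndependentSet G I × ∣ X ∣ + s ≤ 2 * t * ∣ I ∣

    weaken : ∀ {X} → IndependenceBound (2 * t) X → IndependenceBound t X
    weaken (I , I⊆X , ind , bound) = I , I⊆X , ind , weaken-bound _ t bound

    ∣twinsOf∣≤t : ∀ x → ∣ twinsOf x ∣ ≤ t
    ∣twinsOf∣≤t x = twinClass≤t _ (twinsOf-trueTwinClass x)

    TPModuleBound : Subset n → Set
    TPModuleBound X = TriviallyPerfectOn G X → IsModule G X → Nonempty X → IndependenceBound t X

    -- No edge joins X ∩ N[x] to X ─ N[x], so independent sets of the two sides add up.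
    split-at-closedNbh : ∀ {X x r} → WfRec _⊂_ TPModuleBound X → TriviallyPerfectOn G X → IsModule G X →
                         x ∈ X → ClosedNbhClosedIn X x → r ∈ X → ¬ InClosedNbh G x r →
                         IndependenceBound (2 * t) X
    split-at-closedNbh {X} {x} {r} rec tp mod x∈ closed r∈ x∌r =
      combine (rec C⊂X (TriviallyPerfectOn-⊆ C⊆X tp) modC (x , x∈p∩q⁺ (x∈ , ∈N⁺ (inj₁ refl))))
              (rec R⊂X (TriviallyPerfectOn-⊆ R⊆X tp) modR (r , x∈p∧x∉q⇒x∈p─q r∈ (x∌r ∘ ∈N⁻)))
      where
      C = X ∩ N[ x ]
      R = X ─ N[ x ]
      C⊆X = p∩q⊆p X N[ x ]
      R⊆X = p─q⊆p X N[ x ]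
      C⊂X : C ⊂ X
      C⊂X = C⊆X , r , r∈ , x∌r ∘ ∈N⁻ ∘ proj₂ ∘ x∈p∩q⁻ X _
      R⊂X : R ⊂ X
      R⊂X = p∩q≢∅⇒p─q⊂p X N[ x ] (x , x∈p∩q⁺ (x∈ , ∈N⁺ (inj₁ refl)))
      no-edge : ∀ {u w} → u ∈ C → w ∈ R → ¬ Adj G u w
      no-edge u∈ w∈ uw = x∈p─q⇒x∉q X _ w∈
        (∈N⁺ (closed (C⊆X u∈) (∈N⁻ (proj₂ (x∈p∩q⁻ X _ u∈))) (R⊆X w∈) uw))
      modC : IsModule G C
      modC = module-⊆ mod C⊆X λ w∈X w∉C →
        inj₂ λ u∈C → no-edge u∈C (x∈p∧x∉q⇒x∈p─q w∈X (w∉C ∘ λ w∈N → x∈p∩q⁺ (w∈X , w∈N)))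
      modR : IsModule G R
      modR = module-⊆ mod R⊆X λ w∈X w∉R →
        inj₂ λ u∈R → no-edge (x∈p∩q⁺ (w∈X , x∈p∧x∉p─q⇒x∈q w∈X w∉R)) u∈R ∘ Adj-sym
      combine : IndependenceBound t C → IndependenceBound t R → IndependenceBound (2 * t) X
      combine (I , I⊆C , indI , boundC) (J , J⊆R , indJ , boundR) =
        I ∪ J , I∪J⊆X , independent-∪ indI indJ (λ a∈ b∈ → no-edge (I⊆C a∈) (J⊆R b∈)) ,
        subst (λ i → ∣ X ∣ + 2 * t ≤ 2 * t * i) (disjoint⇒∣p∣+∣q∣≡∣p∪q∣ I J disjoint)
          (split-bound _ t (≤-reflexive (∣p∣≡∣p∩q∣+∣p─q∣ X N[ x ])) boundC boundR)
        where
        I∪J⊆X : I ∪ J ⊆ X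
        I∪J⊆X a∈ with x∈p∪q⁻ I J a∈
        ... | inj₁ a∈I = C⊆X (I⊆C a∈I)
        ... | inj₂ a∈J = R⊆X (J⊆R a∈J)
        disjoint : ∀ {a} → a ∈ I → a ∉ J
        disjoint a∈I a∈J = x∈p─q⇒x∉q X _ (J⊆R a∈J) (proj₂ (x∈p∩q⁻ X _ (I⊆C a∈I)))

    bound-without-universal : ∀ {X} → WfRec _⊂_ TPModuleBound X → TriviallyPerfectOn G X → IsModule G X →
                              Nonempty X → (∀ {y} → y ∈ X → ¬ Universal X y) →
                              IndependenceBound (2 * t) X
    bound-without-universal {X} rec tp mod ne no-universal
      with maximiser (λ z → ∣ X ∩ N[ z ] ∣) ne
    ... | x , x∈ , max with any? (λ r → r ∈? X ×-dec ¬? (InClosedNbh? x r))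
    ...   | yes (r , r∈ , x∌r) =
            split-at-closedNbh rec tp mod x∈ (maxDegree⇒closedNbhClosed tp x∈ max) r∈ x∌r
    ...   | no ∄r = ⊥-elim (no-universal x∈ universal)
      where
      universal : Universal X x
      universal {z} z∈ with InClosedNbh? x z
      ... | yes xz = xz
      ... | no x∌z = ⊥-elim (∄r (z , z∈ , x∌z))

    peel-twins : ∀ {X x} → WfRec _⊂_ TPModuleBound X → TriviallyPerfectOn G X → IsModule G X →
                 x ∈ X → Universal X x → IndependenceBound t X
    peel-twins {X} {x} rec tp mod x∈ ux with nonempty? (X ─ twinsOf x)
    ... | no empty =
          ⁅ x ⁆ , ⁅x⁆⊆X , independent-⁅⁆ x ,
          subst (λ i → ∣ X ∣ + t ≤ 2 * t * i) (sym (∣⁅x⁆∣≡1 x))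
            (singleton-bound _ t (≤-trans (p⊆q⇒∣p∣≤∣q∣ X⊆twins) (∣twinsOf∣≤t x)))
      where
      ⁅x⁆⊆X : ⁅ x ⁆ ⊆ X
      ⁅x⁆⊆X y∈ = subst (_∈ X) (sym (x∈⁅y⁆⇒x≡y x y∈)) x∈
      X⊆twins : X ⊆ twinsOf x
      X⊆twins y∈ = x∈p∧x∉p─q⇒x∈q y∈ λ y∈X′ → empty (_ , y∈X′)
    ... | yes ne′ with bound-without-universal (λ Y⊂X′ → rec (⊂-trans Y⊂X′ X′⊂X))
                         (TriviallyPerfectOn-⊆ (p─q⊆p X _) tp) (module-─twinsOf mod ux)
                         ne′ (─twinsOf-no-universal mod x∈ ux)
      where
      X′⊂X : X ─ twinsOf x ⊂ X
      X′⊂X = p∩q≢∅⇒p─q⊂p X (twinsOf x) (x , x∈p∩q⁺ (x∈ , ∈twinsOf⁺ Twins-refl))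
    ... | I , I⊆X′ , ind , bound′ =
          I , p─q⊆p X _ ∘ I⊆X′ , ind ,
          peel-bound _ t (≤-reflexive (∣p∣≡∣p∩q∣+∣p─q∣ X (twinsOf x)))
            (≤-trans (∣p∩q∣≤∣q∣ X _) (∣twinsOf∣≤t x)) bound′

    module-independence-bound : ∀ X → TPModuleBound X
    module-independence-bound = All.wfRec ⊂-wellFounded 0ℓ TPModuleBound step
      where
      step : ∀ X → WfRec _⊂_ TPModuleBound X → TPModuleBound X
      step X rec tp mod ne with any? (λ x → x ∈? X ×-dec Universal? X x)
      ... | yes (x , x∈ , ux) = peel-twins rec tp mod x∈ ux
      ... | no ∄u = weaken (bound-without-universal rec tp mod ne λ y∈ uy → ∄u (_ , y∈ , uy))

trivially-perfect-module-size :
  (G : Graph n) (t a : ℕ) → (∀ T → TrueTwinClass G T → ∣ T ∣ ≤ t) →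
  ∀ M → IsModule G M → TriviallyPerfectOn G M →
  (∀ I → I ⊆ M → IndependentSet G I → ∣ I ∣ < a) → ∣ M ∣ ≤ 2 * t * a
trivially-perfect-module-size {n} G t a twinClass≤t M mod tp α<a with nonempty? M
... | no empty = subst (_≤ 2 * t * a) (sym (trans (cong ∣_∣ (Empty-unique empty)) (∣⊥∣≡0 n))) z≤n
... | yes ne with module-independence-bound G t twinClass≤t M tp mod ne
... | I , I⊆M , ind , bound = begin
  ∣ M ∣           ≤⟨ m≤m+n ∣ M ∣ t ⟩
  ∣ M ∣ + t       ≤⟨ bound ⟩
  2 * t * ∣ I ∣   ≤⟨ *-monoʳ-≤ (2 * t) (<⇒≤ (α<a I I⊆M ind)) ⟩
  2 * t * a       ∎
  where open ≤-Reasoning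

twice-square-≤ : ∀ k → 1 ≤ k → 2 * (2 * k + 5) * (2 * k + 5) ≤ 98 * (k * k)
twice-square-≤ (suc j) _ = begin
  2 * (2 * suc j + 5) * (2 * suc j + 5)                            ≤⟨ m≤m+n _ _ ⟩
  2 * (2 * suc j + 5) * (2 * suc j + 5) + (90 * (j * j) + 140 * j) ≡⟨ expand j ⟩
  98 * (suc j * suc j)                                             ∎
  where
  open ≤-Reasoning
  expand : ∀ j → 2 * (2 * suc j + 5) * (2 * suc j + 5) + (90 * (j * j) + 140 * j) ≡ 98 * (suc j * suc j)
  expand = solve-∀

corollary2 : Σ ℕ λ c → ∀ (n : ℕ) (G : Graph n) (k : ℕ) → 1 ≤ k →
    Reduced G k →
    (∀ (T : Subset n) → TrueTwinClass G T → ∣ T ∣ ≤ 2 * k + 5) →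
    (¬ Σ (Subset n) λ M → IsModule G M × TriviallyPerfectOn G M ×
    Σ (Subset n) λ I → I ⊆ M × IndependentSet G I × 2 * k + 5 ≤ ∣ I ∣) →
    ∀ (M : Subset n) → IsModule G M → TriviallyPerfectOn G M →
    ∣ M ∣ ≤ c * (k * k)
corollary2 = 98 , λ n G k 1≤k _ twinClass≤ no-large-independent M mod tp →
  ≤-trans (trivially-perfect-module-size G (2 * k + 5) (2 * k + 5) twinClass≤ M mod tp
             λ I I⊆M ind → ≰⇒> λ large → no-large-independent (M , mod , tp , I , I⊆M , ind , large))
          (twice-square-≤ k 1≤k)
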